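{- Let $Q$ be a finite connected poset, let $e\in Q$ be neither minimal nor maximal in $Q$, let $Q'=Q\setminus\{e\}$, $D=\{x\in Q: x<e\}$ and $U=\{x\in Q: x>e\}$, and let $X\subseteq\max(Q)$ and $Y\subseteq\min(Q)$ be such that $\{e\}$, $X$, $Y$ are pairwise parallel. Then \[ \alpha(Q',X,Y)+\alpha(Q'/U/D,X,Y)\ge\alpha(Q'/U,X,Y)+\alpha(Q'/D,X,Y). \] Moreover, if $\min(Q)\subseteq D$, $\max(Q)\subseteq U$, $|\min(Q)|\ge 2$ and $|\max(Q)|\ge 2$, then the inequality is strict.
   Context: A subset of a poset is connected if it is non-empty and any two of its elements are joined by a sequence of its elements with consecutive elements comparable. $A\parallel B$ means every element of $A$ is incomparable to every element of $B$. For a poset $R$, $X\subseteq\max(R)$, $Y\subseteq\min(R)$: an antichain $B\subseteq R$ is biconnected in $R$ if $B\,\Delta\,\min(R)$ and $B\,\Delta\,\max(R)$ are both connected; it is an $(X,Y)$-antichain in $R$ if $B\cap\max(R)=X$ and $B\cap\min(R)=Y$; $\alpha(R,X,Y)$ is the number of biconnected $(X,Y)$-antichains in $R$. Contraction: for a filter or order ideal $J$ of a poset $P$, $P/J$ is the poset whose elements are the classes $\{x\}$ for $x\in P\setminus J$ together with the class $J$ (if $J\neq\emptyset$), with $[x]\le[y]$ iff $x'\le y'$ for some $x'\in[x]$, $y'\in[y]$; elements outside $J$ are identified with their singleton classes. Here $U$ is a filter of $Q'$, $D$ is an order ideal of $Q'$ and of $Q'/U$, and $Q'/U/D=(Q'/U)/D$.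 Since $X$ and $Y$ are disjoint from $U\cup D$, they are regarded as sets of maximal, respectively minimal, elements of $Q'$ and of its contractions. -}

module Defs where

open import Level using (0ℓ)
open import Data.Nat using (ℕ; zero; suc; _+_; _≤_; _<_)
import Data.Nat.Properties as ℕP
open import Data.Fin using (Fin; zero; suc)
open import Data.Fin.Properties using (any?; all?; _≟_)
open import Data.Fin.Subset using (Subset; _∈_; _∉_; _∪_; ⁅_⁆; ∣_∣; inside; outside)
  renaming (⊥ to ∅)
open import Data.Fin.Subset.Properties
  using (_∈?_; ∉⊥; ∣⊥∣≡0; ∈⊤; x∈⁅x⁆; x∈⁅y⁆⇒x≡y; p⊆p∪q; x∈p∪q⁻; x∈p∪q⁺; p⊂q⇒∣p∣<∣q∣; ∣p∣≤n; ∣p∣≡n⇒p≡⊤)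
open import Data.List using (List; []; _∷_; _++_; map; filter; length)
open import Data.Vec using ([]; _∷_)
open import Data.Product using (Σ; ∃; _×_; _,_; proj₁; proj₂)
open import Data.Sum using (_⊎_; inj₁; inj₂)
open import Data.Unit using (⊤; tt)
open import Data.Empty using (⊥; ⊥-elim)
open import Relation.Nullary using (¬_; Dec; yes; no; ¬?)
open import Relation.Nullary.Decidable using (_×-dec_; _⊎-dec_; _→-dec_; map′)
open import Relation.Binary.Structures using (IsPartialOrder)
open import Relation.Binary.PropositionalEquality using (_≡_; _≢_; refl; sym; subst; cong)

module _ {n : ℕ} (_~_ : Fin n → Fin n → Set) where

  data Path (S : Fin n → Set) : Fin n → Fin n → Set where
    pnil  : ∀ {x} → Path S x x
    pcons : ∀ {x z y} → S z → x ~ z → Path S z y → Path S x y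

  Connected : (Fin n → Set) → Set
  Connected S = (∃ λ x → S x) × (∀ x y → S x → S y → Path S x y)

  pmap : ∀ {S T : Fin n → Set} → (∀ {v} → S v → T v) →
         ∀ {x y} → Path S x y → Path T x y
  pmap f pnil          = pnil
  pmap f (pcons s r p) = pcons (f s) r (pmap f p)

  private
    Del : (Fin n → Set) → Fin n → Fin n → Set
    Del S x v = S v × v ≢ x

    lemM : ∀ {S x w y} → x ≢ y → Path S w y →
           (w ≢ x × Path (Del S x) w y) ⊎
           (∃ λ z → S z × z ≢ x × x ~ z × Path (Del S x) z y)
    lemM x≢y pnil = inj₁ ((λ eq → x≢y (sym eq)) , pnil)
    lemM {x = x} {w = w} x≢y (pcons {z = v} sv r p) with lemM x≢y p
    ... | inj₂ res = inj₂ res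
    ... | inj₁ (v≢x , q) with w ≟ x
    ...   | yes refl = inj₂ (v , sv , v≢x , r , q)
    ...   | no  w≢x  = inj₁ (w≢x , pcons (sv , v≢x) r q)

    lemL : ∀ {S x y} → x ≢ y → Path S x y →
           ∃ λ z → S z × z ≢ x × x ~ z × Path (Del S x) z y
    lemL x≢y p with lemM x≢y p
    ... | inj₁ (x≢x , _) = ⊥-elim (x≢x refl)
    ... | inj₂ res = res

  module Decide (_~?_ : ∀ x y → Dec (x ~ y))
                (S : Fin n → Set) (S? : ∀ x → Dec (S x)) where

    private
      A : Subset n → Fin n → Set
      A V v = S v × v ∉ V

      go : ∀ k (V : Subset n) → n ≤ ∣ V ∣ + k →
           ∀ x → x ∉ V → ∀ y → Dec (Path (A V) x y)
      go k V h x x∉V y with x ≟ y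
      ... | yes refl = yes pnil
      go zero V h x x∉V y | no x≢y =
        ⊥-elim (x∉V (subst (x ∈_) (sym (∣p∣≡n⇒p≡⊤ V≡))
                       ∈⊤))
        where
          V≡ : ∣ V ∣ ≡ n
          V≡ = ℕP.≤-antisym (∣p∣≤n V)
                 (subst (n ≤_) (ℕP.+-identityʳ ∣ V ∣) h)
      go (suc k) V h x x∉V y | no x≢y =
        map′ forward backward (any? decZ)
        where
          V' = V ∪ ⁅ x ⁆
          grow : ∣ V ∣ < ∣ V' ∣
          grow = p⊂q⇒∣p∣<∣q∣ (p⊆p∪q ⁅ x ⁆ , x , x∈p∪q⁺ (inj₂ (x∈⁅x⁆ x)) , x∉V)
          h' : n ≤ ∣ V' ∣ + k
          h' = ℕP.≤-trans h (subst (_≤ ∣ V' ∣ + k)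
                                   (sym (ℕP.+-suc ∣ V ∣ k))
                                   (ℕP.+-monoˡ-≤ k grow))
          P : Fin n → Set
          P z = A V' z × x ~ z × Path (A V') z y
          decZ : ∀ z → Dec (P z)
          decZ z with S? z | z ∈? V'
          ... | no ¬s | _ = no λ t → ¬s (proj₁ (proj₁ t))
          ... | yes _ | yes z∈ = no λ t → proj₂ (proj₁ t) z∈
          ... | yes s | no z∉ with x ~? z | go k V' h' z z∉ y
          ...   | yes r | yes p = yes ((s , z∉) , r , p)
          ...   | no ¬r | _ = no λ t → ¬r (proj₁ (proj₂ t))
          ...   | _ | no ¬p = no λ t → ¬p (proj₂ (proj₂ t))
          weaken : ∀ {v} → A V' v → A V v
          weaken (s , v∉) = s , λ v∈ → v∉ (x∈p∪q⁺ (inj₁ v∈))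
          conv : ∀ {v} → A V v × v ≢ x → A V' v
          conv ((s , v∉V) , v≢x) = s , λ v∈ → case (x∈p∪q⁻ V ⁅ x ⁆ v∈)
            where
              case : _ ⊎ _ → ⊥
              case (inj₁ v∈V) = v∉V v∈V
              case (inj₂ v∈x) = v≢x (x∈⁅y⁆⇒x≡y x v∈x)
          forward : ∃ P → Path (A V) x y
          forward (z , (s , z∉) , r , p) = pcons (weaken (s , z∉)) r (pmap weaken p)
          backward : Path (A V) x y → ∃ P
          backward p with lemL x≢y p
          ... | (z , az , z≢x , r , q) = z , conv (az , z≢x) , r , pmap conv q

    path? : ∀ x y → Dec (Path S x y)
    path? x y =
      map′ (pmap proj₁) (pmap (λ s → s , ∉⊥))
           (go n ∅ (subst (n ≤_) (sym (cong (_+ n) (∣⊥∣≡0 n))) ℕP.≤-refl) x ∉⊥ y)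
    connected? : Dec (Connected S)
    connected? = any? S? ×-dec
                 all? (λ x → all? (λ y → S? x →-dec (S? y →-dec path? x y)))

-- Finite (relational) structures: elements are the indices i : Fin size
-- with El i; the order relation is _≼_.  All posets below (Q, Q', and
-- the contractions) are represented this way.

record FinRel : Set₁ where
  field
    size : ℕ
    El   : Fin size → Set
    El?  : ∀ x → Dec (El x)
    _≼_  : Fin size → Fin size → Set
    _≼?_ : ∀ x y → Dec (x ≼ y)

module _ (R : FinRel) where
  open FinRel R

  Comparable : Fin size → Fin size → Set
  Comparable x y = x ≼ y ⊎ y ≼ x

  comparable? : ∀ x y → Dec (Comparable x y)
  comparable? x y = (x ≼? y) ⊎-dec (y ≼? x)

  IsMax : Fin size → Set
  IsMax x = El x × (∀ y → El y → x ≼ y → y ≡ x)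

  IsMin : Fin size → Set
  IsMin x = El x × (∀ y → El y → y ≼ x → y ≡ x)

  isMax? : ∀ x → Dec (IsMax x)
  isMax? x = El? x ×-dec all? (λ y → El? y →-dec (x ≼? y →-dec y ≟ x))

  isMin? : ∀ x → Dec (IsMin x)
  isMin? x = El? x ×-dec all? (λ y → El? y →-dec (y ≼? x →-dec y ≟ x))

  ConnectedIn : (Fin size → Set) → Set
  ConnectedIn = Connected Comparable

  SymDiff : Subset size → (Fin size → Set) → Fin size → Set
  SymDiff B M x = (x ∈ B × ¬ M x) ⊎ (x ∉ B × M x)

  IsAntichain : Subset size → Set
  IsAntichain B = (∀ x → x ∈ B → El x) ×
                  (∀ x y → x ∈ B → y ∈ B → x ≢ y → ¬ Comparable x y)

  Biconnected : Subset size → Set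
  Biconnected B = ConnectedIn (SymDiff B IsMin) × ConnectedIn (SymDiff B IsMax)

  IsXYAntichain : Subset size → Subset size → Subset size → Set
  IsXYAntichain X Y B =
    IsAntichain B ×
    (∀ x → ((x ∈ B × IsMax x) → x ∈ X) × (x ∈ X → (x ∈ B × IsMax x))) ×
    (∀ y → ((y ∈ B × IsMin y) → y ∈ Y) × (y ∈ Y → (y ∈ B × IsMin y)))

  Counted : Subset size → Subset size → Subset size → Set
  Counted X Y B = IsXYAntichain X Y B × Biconnected B

  private
    symDiff? : ∀ B {M : Fin size → Set} → (∀ x → Dec (M x)) →
               ∀ x → Dec (SymDiff B M x)
    symDiff? B M? x = ((x ∈? B) ×-dec ¬? (M? x)) ⊎-dec (¬? (x ∈? B) ×-dec M? x)

    connIn? : ∀ B {M : Fin size → Set} → (∀ x → Dec (M x)) →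
              Dec (ConnectedIn (SymDiff B M))
    connIn? B M? = Decide.connected? Comparable comparable? (SymDiff B _) (symDiff? B M?)

  counted? : ∀ X Y B → Dec (Counted X Y B)
  counted? X Y B =
    ((all? (λ x → x ∈? B →-dec El? x) ×-dec
      all? (λ x → all? (λ y → x ∈? B →-dec (y ∈? B →-dec
                  (¬? (x ≟ y) →-dec ¬? (comparable? x y)))))) ×-dec
     all? (λ x → ((x ∈? B ×-dec isMax? x) →-dec x ∈? X) ×-dec
                 (x ∈? X →-dec (x ∈? B ×-dec isMax? x))) ×-dec
     all? (λ y → ((y ∈? B ×-dec isMin? y) →-dec y ∈? Y) ×-dec
                 (y ∈? Y →-dec (y ∈? B ×-dec isMin? y))))
    ×-dec (connIn? B isMin? ×-dec connIn? B isMax?)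

allSubsets : ∀ n → List (Subset n)
allSubsets zero    = [] ∷ []
allSubsets (suc n) = map (outside ∷_) (allSubsets n) ++ map (inside ∷_) (allSubsets n)

α : (R : FinRel) → Subset (FinRel.size R) → Subset (FinRel.size R) → ℕ
α R X Y = length (filter (counted? R X Y) (allSubsets (FinRel.size R)))

delete : (R : FinRel) → Fin (FinRel.size R) → FinRel
delete R e = record
  { size = size ; El = λ x → El x × x ≢ e
  ; El? = λ x → El? x ×-dec ¬? (x ≟ e)
  ; _≼_ = _≼_ ; _≼?_ = _≼?_ }
  where open FinRel R

-- R / J.  Element  zero  is the class J (present iff J ∩ R ≠ ∅), and
-- element  suc x  is the singleton class {x} for x ∈ R ∖ J.
module _ (R : FinRel) (J : Fin (FinRel.size R) → Set)
         (J? : ∀ x → Dec (J x)) where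
  open FinRel R

  Class : Fin (suc size) → Fin size → Set
  Class zero    x' = El x' × J x'
  Class (suc x) x' = x' ≡ x

  class? : ∀ c x' → Dec (Class c x')
  class? zero    x' = El? x' ×-dec J? x'
  class? (suc x) x' = x' ≟ x

  CEl : Fin (suc size) → Set
  CEl zero    = ∃ λ x → El x × J x
  CEl (suc x) = El x × ¬ J x

  cEl? : ∀ c → Dec (CEl c)
  cEl? zero    = any? (λ x → El? x ×-dec J? x)
  cEl? (suc x) = El? x ×-dec ¬? (J? x)

  CLe : Fin (suc size) → Fin (suc size) → Set
  CLe a b = ∃ λ x' → ∃ λ y' → Class a x' × Class b y' × x' ≼ y'

  cLe? : ∀ a b → Dec (CLe a b)
  cLe? a b = any? (λ x' → any? (λ y' → class? a x' ×-dec class? b y' ×-dec x' ≼? y'))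

  contract : FinRel
  contract = record { size = suc size ; El = CEl ; El? = cEl?
                    ; _≼_ = CLe ; _≼?_ = cLe? }

-- a subset of R viewed as a subset of a contraction R / J
-- (elements outside J are identified with their singleton classes)
liftS : ∀ {n} → Subset n → Subset (suc n)
liftS X = outside ∷ X

liftP : ∀ {n} → (Fin n → Set) → Fin (suc n) → Set
liftP J zero    = ⊥
liftP J (suc x) = J x

liftP? : ∀ {n} {J : Fin n → Set} → (∀ x → Dec (J x)) → ∀ x → Dec (liftP J x)
liftP? J? zero    = no λ ()
liftP? J? (suc x) = J? x

record FinPoset (n : ℕ) : Set₁ where
  field
    _⊑_            : Fin n → Fin n → Set
    _⊑?_           : ∀ x y → Dec (x ⊑ y)
    isPartialOrder : IsPartialOrder _≡_ _⊑_

asRel : ∀ {n} → FinPoset n → FinRel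
asRel {n} Q = record { size = n ; El = λ _ → ⊤ ; El? = λ _ → yes tt
                     ; _≼_ = FinPoset._⊑_ Q ; _≼?_ = FinPoset._⊑?_ Q }

module _ {n : ℕ} (Q : FinPoset n) (e : Fin n) where
  open FinPoset Q

  Up : Fin n → Set
  Up x = e ⊑ x × x ≢ e

  up? : ∀ x → Dec (Up x)
  up? x = (e ⊑? x) ×-dec ¬? (x ≟ e)

  Down : Fin n → Set
  Down x = x ⊑ e × x ≢ e

  down? : ∀ x → Dec (Down x)
  down? x = (x ⊑? e) ×-dec ¬? (x ≟ e)

  Q′ : FinRel
  Q′ = delete (asRel Q) e

  Q′/U : FinRel
  Q′/U = contract Q′ Up up?

  Q′/D : FinRel
  Q′/D = contract Q′ Down down?

  Q′/U/D : FinRel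
  Q′/U/D = contract Q′/U (liftP Down) (liftP? down?)

AtLeastTwo : ∀ {n} → (Fin n → Set) → Set
AtLeastTwo S = ∃ λ a → ∃ λ b → a ≢ b × S a × S b

{-# OPTIONS --safe #-}
-- For B ⊆ Q′ let K′, K/U, K/D, K/U/D say that B is a biconnected (X,Y)-antichain of Q′, Q′/U,
-- Q′/D, Q′/U/D respectively.  The class U is maximal in Q′/U but not in X, so the antichains
-- counted by α(Q′/U) avoid it, and dually for Q′/D; summing over B, it suffices to show
-- [K/U] + [K/D] ≤ [K′] + [K/U/D].  Together, K/U and K/D give both K′ and K/U/D.  Alone, K/U gives
-- K′ when B meets D: an element of B below e lies below all of U, so paths of B Δ max(Q′/U)
-- through the class U can be rerouted through it.  Otherwise B avoids U ∪ D, and contracting D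
-- turns K/U into K/U/D.  Dually for K/D.
-- Strictness comes from B = ∅: min(Q′/U) contains two minimal elements of Q, which no path of
-- minimal elements joins, so K/U fails, and dually K/D; whereas Q′/U/D has the class D as its only
-- minimal and the class U as its only maximal element, and X = Y = ∅, so K/U/D holds.
module Submission where

open import Defs
open import Function using (_∘_; flip)
open import Data.Nat using (ℕ; zero; suc; _+_; _≤_; _<_; z≤n)
open import Data.Nat.Properties
  using (≤-refl; ≤-trans; ≤-reflexive; ≤-<-trans; <-≤-trans; m≤m+n; m≤n+m; +-identityʳ;
         +-mono-≤; +-mono-<-≤; +-mono-≤-<; +-commutativeSemigroup)
open import Algebra.Properties.CommutativeSemigroup +-commutativeSemigroup using (interchange)
open import Data.Fin using (Fin; zero; suc)
open import Data.Fin.Properties using (any?; _≟_; suc-injective)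
open import Data.Fin.Induction using (po-wellFounded; po-noetherian)
open import Data.Fin.Subset using (Subset; _∈_; _∉_; inside; outside) renaming (⊥ to ∅)
open import Data.Fin.Subset.Properties using (_∈?_; ∉⊥; drop-there)
open import Data.Vec using ([]; _∷_; here; there)
open import Data.List using (List; []; _∷_; _++_; map; filter; length)
open import Data.List.Properties using (length-++; filter-++; filter-none)
open import Data.List.Membership.Propositional using () renaming (_∈_ to _∈ₗ_)
open import Data.List.Membership.Propositional.Properties using (∈-map⁺; ∈-++⁺ˡ; ∈-++⁺ʳ)
open import Data.List.Relation.Unary.All using (universal)
import Data.List.Relation.Unary.Any as Any
open import Data.Product using (∃; _×_; _,_; proj₁; proj₂)
open import Data.Sum using (_⊎_; inj₁; inj₂; swap)
open import Data.Unit using (⊤; tt)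
open import Data.Empty using (⊥-elim)
open import Induction.WellFounded using (Acc; acc)
open import Relation.Nullary using (¬_; Dec; yes; no; ¬?)
open import Relation.Nullary.Decidable using (_×-dec_; decidable-stable)
open import Relation.Unary using (Decidable)
open import Relation.Binary.Structures using (IsPartialOrder)
import Relation.Binary.Construct.NonStrictToStrict as ToStrict
open import Relation.Binary.PropositionalEquality
  using (_≡_; _≢_; refl; sym; trans; subst; subst₂; cong; cong₂; ≢-sym)

module _ {m : ℕ} {_~_ : Fin m → Fin m → Set} where

  _++ₚ_ : ∀ {S x y z} → Path _~_ S x y → Path _~_ S y z → Path _~_ S x z
  pnil        ++ₚ q = q
  pcons s r p ++ₚ q = pcons s r (p ++ₚ q)

  reverseₚ : (∀ {x y} → x ~ y → y ~ x) →
             ∀ {S x y} → S x → Path _~_ S x y → Path _~_ S y x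
  reverseₚ sym~ sx pnil           = pnil
  reverseₚ sym~ sx (pcons sz r p) = reverseₚ sym~ sz p ++ₚ pcons sx (sym~ r) pnil

module _ {a b : ℕ} {_~_ : Fin a → Fin a → Set} {_≈_ : Fin b → Fin b → Set}
         {S : Fin a → Set} {T : Fin b → Set} (f : Fin a → Fin b)
         (f-into : ∀ {x} → S x → T (f x))
         (f-rel : ∀ {x y} → S x → S y → x ~ y → f x ≈ f y ⊎ f x ≡ f y)
         (f-onto : ∀ {z} → T z → ∃ λ x → S x × f x ≡ z) where

  map-path : ∀ {x y} → S x → Path _~_ S x y → Path _≈_ T (f x) (f y)
  map-path sx pnil = pnil
  map-path {y = y} sx (pcons sz r p) with f-rel sx sz r
  ... | inj₁ r′ = pcons (f-into sz) r′ (map-path sz p)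
  ... | inj₂ eq = subst (λ w → Path _≈_ T w (f y)) (sym eq) (map-path sz p)

  connected-image : Connected _~_ S → Connected _≈_ T
  connected-image ((x , sx) , paths) = (f x , f-into sx) , paths′
    where
      paths′ : ∀ z z′ → T z → T z′ → Path _≈_ T z z′
      paths′ z z′ tz tz′ with f-onto tz | f-onto tz′
      ... | x , sx , refl | x′ , sx′ , refl = map-path sx (paths x x′ sx sx′)

module _ (R : FinRel) where
  open FinRel R

  path-within-minimal⇒≡ : ∀ {S : Fin size → Set} → (∀ z → S z → IsMin R z) →
                          ∀ {x y} → IsMin R x → Path (Comparable R) S x y → y ≡ x
  path-within-minimal⇒≡ S-min mx pnil = refl
  path-within-minimal⇒≡ S-min {x} mx (pcons {z = z} sz x~z p) =
    trans (path-within-minimal⇒≡ S-min (S-min z sz) p) (step x~z)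
    where
      step : Comparable R x z → z ≡ x
      step (inj₁ x≼z) = sym (proj₂ (S-min z sz) x (proj₁ mx) x≼z)
      step (inj₂ z≼x) = proj₂ mx z (proj₁ (S-min z sz)) z≼x

  path-within-maximal⇒≡ : ∀ {S : Fin size → Set} → (∀ z → S z → IsMax R z) →
                          ∀ {x y} → IsMax R x → Path (Comparable R) S x y → y ≡ x
  path-within-maximal⇒≡ S-max mx pnil = refl
  path-within-maximal⇒≡ S-max {x} mx (pcons {z = z} sz x~z p) =
    trans (path-within-maximal⇒≡ S-max (S-max z sz) p) (step x~z)
    where
      step : Comparable R x z → z ≡ x
      step (inj₁ x≼z) = proj₂ mx z (proj₁ (S-max z sz)) x≼z
      step (inj₂ z≼x) = sym (proj₂ (S-max z sz) x (proj₁ mx) z≼x)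

  ConnectedΔmin : Subset size → Set
  ConnectedΔmin B = ConnectedIn R (SymDiff R B (IsMin R))

  ConnectedΔmax : Subset size → Set
  ConnectedΔmax B = ConnectedIn R (SymDiff R B (IsMax R))

  symDiff-∅⁻ : ∀ (P : Fin size → Set) {x} → SymDiff R ∅ P x → P x
  symDiff-∅⁻ _ (inj₁ (x∈∅ , _)) = ⊥-elim (∉⊥ x∈∅)
  symDiff-∅⁻ _ (inj₂ (_ , px))  = px

  ¬connectedΔmin-∅ : ∀ {a b} → a ≢ b → IsMin R a → IsMin R b → ¬ ConnectedΔmin ∅
  ¬connectedΔmin-∅ a≢b ma mb (_ , paths) =
    a≢b (sym (path-within-minimal⇒≡ (λ _ → symDiff-∅⁻ (IsMin R)) ma
                                   (paths _ _ (inj₂ (∉⊥ , ma)) (inj₂ (∉⊥ , mb)))))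

  ¬connectedΔmax-∅ : ∀ {a b} → a ≢ b → IsMax R a → IsMax R b → ¬ ConnectedΔmax ∅
  ¬connectedΔmax-∅ a≢b ma mb (_ , paths) =
    a≢b (sym (path-within-maximal⇒≡ (λ _ → symDiff-∅⁻ (IsMax R)) ma
                                   (paths _ _ (inj₂ (∉⊥ , ma)) (inj₂ (∉⊥ , mb)))))

  connectedΔmin-∅ : ∀ {z} → IsMin R z → (∀ x → IsMin R x → x ≡ z) → ConnectedΔmin ∅
  connectedΔmin-∅ {z} mz unique = (z , inj₂ (∉⊥ , mz)) , λ x y sx sy →
    trivial (unique x (symDiff-∅⁻ (IsMin R) sx)) (unique y (symDiff-∅⁻ (IsMin R) sy))
    where
      trivial : ∀ {x y} → x ≡ z → y ≡ z → Path (Comparable R) (SymDiff R ∅ (IsMin R)) x y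
      trivial refl refl = pnil

  connectedΔmax-∅ : ∀ {z} → IsMax R z → (∀ x → IsMax R x → x ≡ z) → ConnectedΔmax ∅
  connectedΔmax-∅ {z} mz unique = (z , inj₂ (∉⊥ , mz)) , λ x y sx sy →
    trivial (unique x (symDiff-∅⁻ (IsMax R) sx)) (unique y (symDiff-∅⁻ (IsMax R) sy))
    where
      trivial : ∀ {x y} → x ≡ z → y ≡ z → Path (Comparable R) (SymDiff R ∅ (IsMax R)) x y
      trivial refl refl = pnil

  ∅-isXYAntichain : ∀ {X Y} → (∀ x → x ∉ X) → (∀ y → y ∉ Y) → IsXYAntichain R X Y ∅
  ∅-isXYAntichain X-empty Y-empty =
    ((λ x x∈∅ → ⊥-elim (∉⊥ x∈∅)) , (λ x _ x∈∅ → ⊥-elim (∉⊥ x∈∅))) ,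
    (λ x → (λ (x∈∅ , _) → ⊥-elim (∉⊥ x∈∅)) , (λ x∈X → ⊥-elim (X-empty x x∈X))) ,
    (λ y → (λ (y∈∅ , _) → ⊥-elim (∉⊥ y∈∅)) , (λ y∈Y → ⊥-elim (Y-empty y y∈Y)))

_∩_≐_ : ∀ {k} → Subset k → (Fin k → Set) → Subset k → Set
B ∩ P ≐ Z = ∀ x → ((x ∈ B × P x) → x ∈ Z) × (x ∈ Z → x ∈ B × P x)

module Contraction (R : FinRel) (J : Fin (FinRel.size R) → Set) (J? : ∀ x → Dec (J x)) where
  open FinRel R

  R/J : FinRel
  R/J = contract R J J?

  Avoids : Subset size → Set
  Avoids B = ∀ x → x ∈ B → ¬ J x

  isMax-suc⁻ : ∀ {x} → IsMax R/J (suc x) → IsMax R x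
  isMax-suc⁻ {x} ((elx , _) , max) = elx , max′
    where
      max′ : ∀ y → El y → x ≼ y → y ≡ x
      max′ y ely x≼y with J? y
      ... | yes jy with () ← max zero (y , ely , jy) (x , y , refl , (ely , jy) , x≼y)
      ... | no ¬jy = suc-injective (max (suc y) (ely , ¬jy) (x , y , refl , refl , x≼y))

  isMax-suc⁺ : ∀ {x} → IsMax R x → ¬ J x → IsMax R/J (suc x)
  isMax-suc⁺ {x} (elx , max) ¬jx = (elx , ¬jx) , max′
    where
      max′ : ∀ c → FinRel.El R/J c → FinRel._≼_ R/J (suc x) c → c ≡ suc x
      max′ zero    _ (_ , y , refl , (ely , jy) , x≼y) = ⊥-elim (¬jx (subst J (max y ely x≼y) jy))
      max′ (suc y) (ely , _) (_ , _ , refl , refl , x≼y) = cong suc (max y ely x≼y)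

  isMin-suc⁻ : ∀ {x} → IsMin R/J (suc x) → IsMin R x
  isMin-suc⁻ {x} ((elx , _) , min) = elx , min′
    where
      min′ : ∀ y → El y → y ≼ x → y ≡ x
      min′ y ely y≼x with J? y
      ... | yes jy with () ← min zero (y , ely , jy) (y , x , (ely , jy) , refl , y≼x)
      ... | no ¬jy = suc-injective (min (suc y) (ely , ¬jy) (y , x , refl , refl , y≼x))

  isMin-suc⁺ : ∀ {x} → IsMin R x → ¬ J x → IsMin R/J (suc x)
  isMin-suc⁺ {x} (elx , min) ¬jx = (elx , ¬jx) , min′
    where
      min′ : ∀ c → FinRel.El R/J c → FinRel._≼_ R/J c (suc x) → c ≡ suc x
      min′ zero    _ (y , _ , (ely , jy) , refl , y≼x) = ⊥-elim (¬jx (subst J (min y ely y≼x) jy))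
      min′ (suc y) (ely , _) (_ , _ , refl , refl , y≼x) = cong suc (min y ely y≼x)

  comparable-suc⁺ : ∀ {x y} → Comparable R x y → Comparable R/J (suc x) (suc y)
  comparable-suc⁺ (inj₁ x≼y) = inj₁ (_ , _ , refl , refl , x≼y)
  comparable-suc⁺ (inj₂ y≼x) = inj₂ (_ , _ , refl , refl , y≼x)

  comparable-suc⁻ : ∀ {x y} → Comparable R/J (suc x) (suc y) → Comparable R x y
  comparable-suc⁻ (inj₁ (_ , _ , refl , refl , x≼y)) = inj₁ x≼y
  comparable-suc⁻ (inj₂ (_ , _ , refl , refl , y≼x)) = inj₂ y≼x

  comparable-class⁺ : ∀ {x y} → J x → El x → Comparable R x y → Comparable R/J zero (suc y)
  comparable-class⁺ jx elx (inj₁ x≼y) = inj₁ (_ , _ , (elx , jx) , refl , x≼y)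
  comparable-class⁺ jx elx (inj₂ y≼x) = inj₂ (_ , _ , refl , (elx , jx) , y≼x)

  comparable-class⁻ : ∀ {y} → Comparable R/J zero (suc y) → ∃ λ j → El j × J j × Comparable R j y
  comparable-class⁻ (inj₁ (j , _ , (elj , jj) , refl , j≼y)) = j , elj , jj , inj₁ j≼y
  comparable-class⁻ (inj₂ (_ , j , refl , (elj , jj) , y≼j)) = j , elj , jj , inj₂ y≼j

  isAntichain-lift⁻ : ∀ {B} → IsAntichain R/J (liftS B) → IsAntichain R B × Avoids B
  isAntichain-lift⁻ (inR/J , incomparable) =
    ((λ x x∈B → proj₁ (inR/J (suc x) (there x∈B))) ,
     (λ x y x∈B y∈B x≢y x~y → incomparable (suc x) (suc y) (there x∈B) (there y∈B)
                                (λ eq → x≢y (suc-injective eq)) (comparable-suc⁺ x~y))) ,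
    (λ x x∈B → proj₂ (inR/J (suc x) (there x∈B)))

  isAntichain-lift⁺ : ∀ {B} → IsAntichain R B → Avoids B → IsAntichain R/J (liftS B)
  isAntichain-lift⁺ {B} (inR , incomparable) avoids = inR/J , incomparable′
    where
      inR/J : ∀ c → c ∈ liftS B → FinRel.El R/J c
      inR/J (suc x) (there x∈B) = inR x x∈B , avoids x x∈B
      incomparable′ : ∀ c c′ → c ∈ liftS B → c′ ∈ liftS B → c ≢ c′ → ¬ Comparable R/J c c′
      incomparable′ (suc x) (suc y) (there x∈B) (there y∈B) x≢y x~y =
        incomparable x y x∈B y∈B (λ eq → x≢y (cong suc eq)) (comparable-suc⁻ x~y)

  module Extremal (P : Fin size → Set) (P′ : Fin (suc size) → Set)
                  (P-el : ∀ {x} → P x → El x) (P′-el : ∀ {c} → P′ c → FinRel.El R/J c)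
                  (P′⇒P : ∀ {x} → P′ (suc x) → P x)
                  (P⇒P′ : ∀ {x} → P x → ¬ J x → P′ (suc x)) where

    trace-lift⁻ : ∀ {B Z} → Avoids B → liftS B ∩ P′ ≐ liftS Z → B ∩ P ≐ Z
    trace-lift⁻ avoids trace x =
      (λ (x∈B , px) → drop-there (proj₁ (trace (suc x)) (there x∈B , P⇒P′ px (avoids x x∈B)))) ,
      (λ x∈Z → let (x∈B , px) = proj₂ (trace (suc x)) (there x∈Z) in drop-there x∈B , P′⇒P px)

    trace-lift⁺ : ∀ {B Z} → Avoids Z → B ∩ P ≐ Z → liftS B ∩ P′ ≐ liftS Z
    trace-lift⁺ avoidsZ trace zero = (λ ()) , (λ ())
    trace-lift⁺ avoidsZ trace (suc x) =
      (λ { (there x∈B , px) → there (proj₁ (trace x) (x∈B , P′⇒P px)) }) ,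
      (λ { (there x∈Z) → let (x∈B , px) = proj₂ (trace x) x∈Z
                         in  there x∈B , P⇒P′ px (avoidsZ x x∈Z) })

    symDiff-suc⁺ : ∀ {B x} → SymDiff R B P x → ¬ J x → SymDiff R/J (liftS B) P′ (suc x)
    symDiff-suc⁺ (inj₁ (x∈B , ¬px)) ¬jx = inj₁ (there x∈B , λ p′ → ¬px (P′⇒P p′))
    symDiff-suc⁺ (inj₂ (x∉B , px))  ¬jx = inj₂ ((λ x∈B → x∉B (drop-there x∈B)) , P⇒P′ px ¬jx)

    symDiff-suc⁻ : ∀ {B x} → Avoids B → SymDiff R/J (liftS B) P′ (suc x) → SymDiff R B P x × ¬ J x
    symDiff-suc⁻ avoids (inj₁ (there x∈B , ¬p′)) =
      inj₁ (x∈B , λ px → ¬p′ (P⇒P′ px (avoids _ x∈B))) , avoids _ x∈B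
    symDiff-suc⁻ avoids (inj₂ (x∉B , p′)) =
      inj₂ ((λ x∈B → x∉B (there x∈B)) , P′⇒P p′) , proj₂ (P′-el p′)

    symDiff-zero⁻ : ∀ {B} → SymDiff R/J (liftS B) P′ zero → P′ zero
    symDiff-zero⁻ (inj₂ (_ , p′)) = p′

    symDiff-zero⁺ : ∀ {B} → P′ zero → SymDiff R/J (liftS B) P′ zero
    symDiff-zero⁺ p′ = inj₂ ((λ ()) , p′)

    module _ {B : Subset size} (avoids : Avoids B) where
      private
        S : Fin size → Set
        S = SymDiff R B P
        T : Fin (suc size) → Set
        T = SymDiff R/J (liftS B) P′

      module _ (P-avoids : ∀ {x} → P x → ¬ J x) (¬P′zero : ¬ P′ zero) where
        private
          S-avoids : ∀ {x} → S x → ¬ J x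
          S-avoids (inj₁ (x∈B , _)) = avoids _ x∈B
          S-avoids (inj₂ (_ , px))  = P-avoids px

        connected-lift⁻ : Connected (Comparable R/J) T → Connected (Comparable R) S
        connected-lift⁻ ((zero , t) , _) = ⊥-elim (¬P′zero (symDiff-zero⁻ t))
        connected-lift⁻ connT@((suc x₀ , _) , _) = connected-image f f-into f-rel f-onto connT
          where
            f : Fin (suc size) → Fin size
            f zero    = x₀
            f (suc x) = x
            f-into : ∀ {c} → T c → S (f c)
            f-into {zero}  t = ⊥-elim (¬P′zero (symDiff-zero⁻ t))
            f-into {suc x} t = proj₁ (symDiff-suc⁻ avoids t)
            f-rel : ∀ {c c′} → T c → T c′ → Comparable R/J c c′ →
                    Comparable R (f c) (f c′) ⊎ f c ≡ f c′
            f-rel {zero}          t _ _ = ⊥-elim (¬P′zero (symDiff-zero⁻ t))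
            f-rel {suc _} {zero}  _ t _ = ⊥-elim (¬P′zero (symDiff-zero⁻ t))
            f-rel {suc _} {suc _} _ _ c~c′ = inj₁ (comparable-suc⁻ c~c′)
            f-onto : ∀ {x} → S x → ∃ λ c → T c × f c ≡ x
            f-onto {x} s = suc x , symDiff-suc⁺ s (S-avoids s) , refl

        connected-lift⁺ : Connected (Comparable R) S → Connected (Comparable R/J) T
        connected-lift⁺ = connected-image suc f-into (λ _ _ x~y → inj₁ (comparable-suc⁺ x~y)) f-onto
          where
            f-into : ∀ {x} → S x → T (suc x)
            f-into s = symDiff-suc⁺ s (S-avoids s)
            f-onto : ∀ {c} → T c → ∃ λ x → S x × suc x ≡ c
            f-onto {zero}  t = ⊥-elim (¬P′zero (symDiff-zero⁻ t))
            f-onto {suc x} t = x , proj₁ (symDiff-suc⁻ avoids t) , refl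

      connected-collapse : (∀ x → x ∈ B → El x) → P′ zero → (∃ λ x → P x × J x) →
                           Connected (Comparable R) S → Connected (Comparable R/J) T
      connected-collapse B-el p′0 (x₀ , px₀ , jx₀) = connected-image collapse f-into f-rel f-onto
        where
          collapse : Fin size → Fin (suc size)
          collapse x with J? x
          ... | yes _ = zero
          ... | no  _ = suc x
          collapse-J : ∀ {x} → J x → collapse x ≡ zero
          collapse-J {x} jx with J? x
          ... | yes _  = refl
          ... | no ¬jx = ⊥-elim (¬jx jx)
          collapse-∉J : ∀ {x} → ¬ J x → collapse x ≡ suc x
          collapse-∉J {x} ¬jx with J? x
          ... | yes jx = ⊥-elim (¬jx jx)
          ... | no _   = refl
          S-el : ∀ {x} → S x → El x
          S-el (inj₁ (x∈B , _)) = B-el _ x∈B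
          S-el (inj₂ (_ , px))  = P-el px
          f-into : ∀ {x} → S x → T (collapse x)
          f-into {x} s with J? x
          ... | yes _  = symDiff-zero⁺ p′0
          ... | no ¬jx = symDiff-suc⁺ s ¬jx
          f-rel : ∀ {x y} → S x → S y → Comparable R x y →
                  Comparable R/J (collapse x) (collapse y) ⊎ collapse x ≡ collapse y
          f-rel {x} {y} sx sy x~y with J? x | J? y
          ... | yes _  | yes _  = inj₂ refl
          ... | yes jx | no _   = inj₁ (comparable-class⁺ jx (S-el sx) x~y)
          ... | no _   | yes jy = inj₁ (swap (comparable-class⁺ jy (S-el sy) (swap x~y)))
          ... | no _   | no _   = inj₁ (comparable-suc⁺ x~y)
          f-onto : ∀ {c} → T c → ∃ λ x → S x × collapse x ≡ c
          f-onto {zero}  t = x₀ , inj₂ ((λ x₀∈B → avoids x₀ x₀∈B jx₀) , px₀) , collapse-J jx₀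
          f-onto {suc x} t = let (s , ¬jx) = symDiff-suc⁻ avoids t in x , s , collapse-∉J ¬jx

      -- Each step of a path of T into or out of the class becomes a detour through h.
      connected-reroute : (h : Fin size) → S h → ¬ J h →
        (∀ x j → J j → Comparable R x j → ∃ λ m → S m × Comparable R x m × Comparable R h m) →
        (∀ x → J x → Comparable R h x) →
        Connected (Comparable R/J) T → Connected (Comparable R) S
      connected-reroute h sh ¬jh detour h~J (_ , pathsT) =
        (h , sh) , λ x y sx sy → to-h sx ++ₚ reverseₚ swap sy (to-h sy)
        where
          real : Fin (suc size) → Fin size
          real zero    = h
          real (suc x) = x
          detour-class : ∀ {w} → Comparable R/J zero (suc w) →
                         ∃ λ m → S m × Comparable R w m × Comparable R h m
          detour-class c~w = let (j , _ , jj , j~w) = comparable-class⁻ c~w in detour _ j jj (swap j~w)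
          step : ∀ c c′ → T c′ → Comparable R/J c c′ → Path (Comparable R) S (real c) (real c′)
          step zero zero _ _ = pnil
          step zero (suc w) t c~w with detour-class c~w
          ... | m , sm , w~m , h~m = pcons sm h~m (pcons (proj₁ (symDiff-suc⁻ avoids t)) (swap w~m) pnil)
          step (suc w) zero _ w~c with detour-class (swap w~c)
          ... | m , sm , w~m , h~m = pcons sm w~m (pcons sh (swap h~m) pnil)
          step (suc _) (suc _) t w~w′ = pcons (proj₁ (symDiff-suc⁻ avoids t)) (comparable-suc⁻ w~w′) pnil
          realise : ∀ {c c′} → Path (Comparable R/J) T c c′ → Path (Comparable R) S (real c) (real c′)
          realise pnil              = pnil
          realise (pcons t c~c″ p) = step _ _ t c~c″ ++ₚ realise p
          to-h : ∀ {x} → S x → Path (Comparable R) S x h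
          to-h {x} sx with J? x
          ... | yes jx = pcons sh (swap (h~J x jx)) pnil
          ... | no ¬jx = realise (pathsT (suc x) (suc h) (symDiff-suc⁺ sx ¬jx) (symDiff-suc⁺ sh ¬jh))

  module Minimal = Extremal (IsMin R) (IsMin R/J) proj₁ proj₁ isMin-suc⁻ isMin-suc⁺
  module Maximal = Extremal (IsMax R) (IsMax R/J) proj₁ proj₁ isMax-suc⁻ isMax-suc⁺

  isXYAntichain-lift⁻ : ∀ {X Y B} → IsXYAntichain R/J (liftS X) (liftS Y) (liftS B) →
                        IsXYAntichain R X Y B × Avoids B
  isXYAntichain-lift⁻ (anti , maxTrace , minTrace) =
    let (anti′ , avoids) = isAntichain-lift⁻ anti
    in  (anti′ , Maximal.trace-lift⁻ avoids maxTrace , Minimal.trace-lift⁻ avoids minTrace) , avoids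

  isXYAntichain-lift⁺ : ∀ {X Y B} → Avoids X → Avoids Y → Avoids B → IsXYAntichain R X Y B →
                        IsXYAntichain R/J (liftS X) (liftS Y) (liftS B)
  isXYAntichain-lift⁺ avoidsX avoidsY avoidsB (anti , maxTrace , minTrace) =
    isAntichain-lift⁺ anti avoidsB ,
    Maximal.trace-lift⁺ avoidsX maxTrace , Minimal.trace-lift⁺ avoidsY minTrace

  ¬counted-inside-if-class-max : IsMax R/J zero → ∀ {X Y B} → ¬ Counted R/J (liftS X) Y (inside ∷ B)
  ¬counted-inside-if-class-max class-max ((_ , maxTrace , _) , _)
    with () ← proj₁ (maxTrace zero) (here , class-max)

  ¬counted-inside-if-class-min : IsMin R/J zero → ∀ {X Y B} → ¬ Counted R/J X (liftS Y) (inside ∷ B)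
  ¬counted-inside-if-class-min class-min ((_ , _ , minTrace) , _)
    with () ← proj₁ (minTrace zero) (here , class-min)


indicator : ∀ {A : Set} → Dec A → ℕ
indicator (yes _) = 1
indicator (no _)  = 0

1≤indicator : ∀ {C : Set} (c : Dec C) → C → 1 ≤ indicator c
1≤indicator (yes _) _ = ≤-refl
1≤indicator (no ¬c) c = ⊥-elim (¬c c)

module _ {A B C D : Set} where

  1≤indicator-+ : (c : Dec C) (d : Dec D) → C ⊎ D → 1 ≤ indicator c + indicator d
  1≤indicator-+ c d (inj₁ x) = ≤-trans (1≤indicator c x) (m≤m+n _ _)
  1≤indicator-+ c d (inj₂ y) = ≤-trans (1≤indicator d y) (m≤n+m _ _)

  indicator-+-≤ : (a : Dec A) (b : Dec B) (c : Dec C) (d : Dec D) →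
                  (A → B → C × D) → (A → C ⊎ D) → (B → C ⊎ D) →
                  indicator a + indicator b ≤ indicator c + indicator d
  indicator-+-≤ (yes a) (yes b) c d both _ _ =
    +-mono-≤ (1≤indicator c (proj₁ (both a b))) (1≤indicator d (proj₂ (both a b)))
  indicator-+-≤ (yes a) (no _)  c d _ one _ = 1≤indicator-+ c d (one a)
  indicator-+-≤ (no _)  (yes b) c d _ _ one = 1≤indicator-+ c d (one b)
  indicator-+-≤ (no _)  (no _)  _ _ _ _ _   = z≤n

  indicator-+-< : (a : Dec A) (b : Dec B) (c : Dec C) (d : Dec D) → ¬ A → ¬ B → C ⊎ D →
                  indicator a + indicator b < indicator c + indicator d
  indicator-+-< (yes a) _       _ _ ¬a _  _  = ⊥-elim (¬a a)
  indicator-+-< (no _)  (yes b) _ _ _  ¬b _  = ⊥-elim (¬b b)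
  indicator-+-< (no _)  (no _)  c d _  _  cd = 1≤indicator-+ c d cd

module _ {A : Set} {P : A → Set} (P? : Decidable P) where

  length-filter-∷ : ∀ x xs → length (filter P? (x ∷ xs)) ≡ indicator (P? x) + length (filter P? xs)
  length-filter-∷ x xs with P? x
  ... | yes _ = refl
  ... | no _  = refl

  length-filter-++ : ∀ xs ys → length (filter P? (xs ++ ys)) ≡ length (filter P? xs) + length (filter P? ys)
  length-filter-++ xs ys = trans (cong length (filter-++ P? xs ys)) (length-++ (filter P? xs))

length-filter-map : ∀ {A B : Set} {P : B → Set} (P? : Decidable P) (f : A → B) xs →
                    length (filter P? (map f xs)) ≡ length (filter (P? ∘ f) xs)
length-filter-map P? f []       = refl
length-filter-map P? f (x ∷ xs) with P? (f x)
... | yes _ = cong suc (length-filter-map P? f xs)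
... | no _  = length-filter-map P? f xs

module _ {A : Set} {P₁ P₂ P₃ P₄ : A → Set}
         (P₁? : Decidable P₁) (P₂? : Decidable P₂) (P₃? : Decidable P₃) (P₄? : Decidable P₄) where

  private
    count₂ : ∀ {P Q : A → Set} → Decidable P → Decidable Q → List A → ℕ
    count₂ P? Q? xs = length (filter P? xs) + length (filter Q? xs)

    count₂-∷ : ∀ {P Q : A → Set} (P? : Decidable P) (Q? : Decidable Q) x xs →
               count₂ P? Q? (x ∷ xs) ≡ (indicator (P? x) + indicator (Q? x)) + count₂ P? Q? xs
    count₂-∷ P? Q? x xs =
      trans (cong₂ _+_ (length-filter-∷ P? x xs) (length-filter-∷ Q? x xs))
            (interchange (indicator (P? x)) _ (indicator (Q? x)) _)

  module _ (pointwise : ∀ x → indicator (P₁? x) + indicator (P₂? x) ≤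
                              indicator (P₃? x) + indicator (P₄? x)) where

    length-filter-+-≤ : ∀ xs → length (filter P₁? xs) + length (filter P₂? xs) ≤
                               length (filter P₃? xs) + length (filter P₄? xs)
    length-filter-+-≤ []       = z≤n
    length-filter-+-≤ (x ∷ xs) =
      subst₂ _≤_ (sym (count₂-∷ P₁? P₂? x xs)) (sym (count₂-∷ P₃? P₄? x xs))
             (+-mono-≤ (pointwise x) (length-filter-+-≤ xs))

    length-filter-+-< : ∀ {x₀} → indicator (P₁? x₀) + indicator (P₂? x₀) <
                                 indicator (P₃? x₀) + indicator (P₄? x₀) →
                        ∀ {xs} → x₀ ∈ₗ xs → length (filter P₁? xs) + length (filter P₂? xs) <
                                             length (filter P₃? xs) + length (filter P₄? xs)
    length-filter-+-< strict {x ∷ xs} (Any.here refl) =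
      subst₂ _<_ (sym (count₂-∷ P₁? P₂? x xs)) (sym (count₂-∷ P₃? P₄? x xs))
             (+-mono-<-≤ strict (length-filter-+-≤ xs))
    length-filter-+-< strict {x ∷ xs} (Any.there x₀∈xs) =
      subst₂ _<_ (sym (count₂-∷ P₁? P₂? x xs)) (sym (count₂-∷ P₃? P₄? x xs))
             (+-mono-≤-< (pointwise x) (length-filter-+-< strict x₀∈xs))

∈-allSubsets : ∀ {m} (B : Subset m) → B ∈ₗ allSubsets m
∈-allSubsets []            = Any.here refl
∈-allSubsets (outside ∷ B) = ∈-++⁺ˡ (∈-map⁺ (outside ∷_) (∈-allSubsets B))
∈-allSubsets (inside ∷ B)  = ∈-++⁺ʳ _ (∈-map⁺ (inside ∷_) (∈-allSubsets B))

module _ {m : ℕ} {P : Subset (suc m) → Set} (P? : Decidable P) where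

  length-filter-allSubsets-suc :
    length (filter P? (allSubsets (suc m))) ≡
    length (filter (P? ∘ liftS) (allSubsets m)) + length (filter (P? ∘ (inside ∷_)) (allSubsets m))
  length-filter-allSubsets-suc =
    trans (length-filter-++ P? (map (outside ∷_) (allSubsets m)) _)
          (cong₂ _+_ (length-filter-map P? (outside ∷_) (allSubsets m))
                     (length-filter-map P? (inside ∷_) (allSubsets m)))

  length-filter-allSubsets-outside-≤ :
    length (filter (P? ∘ liftS) (allSubsets m)) ≤ length (filter P? (allSubsets (suc m)))
  length-filter-allSubsets-outside-≤ = ≤-trans (m≤m+n _ _) (≤-reflexive (sym length-filter-allSubsets-suc))

  length-filter-allSubsets-outside : (∀ B → ¬ P (inside ∷ B)) →
    length (filter P? (allSubsets (suc m))) ≡ length (filter (P? ∘ liftS) (allSubsets m))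
  length-filter-allSubsets-outside ¬P-inside =
    trans length-filter-allSubsets-suc
          (trans (cong (length (filter (P? ∘ liftS) (allSubsets m)) +_)
                       (cong length (filter-none (P? ∘ (inside ∷_)) (universal ¬P-inside (allSubsets m)))))
                 (+-identityʳ _))

-- Use this rather than unfolding α in place: at a concrete contraction, that conversion
-- check normalises the decision procedure counted? and takes minutes.
α-unfold : ∀ R X Y → α R X Y ≡ length (filter (counted? R X Y) (allSubsets (FinRel.size R)))
α-unfold R X Y = refl

module FinitePoset {n : ℕ} (Q : FinPoset n) where
  open FinPoset Q
  open IsPartialOrder isPartialOrder using () renaming (refl to ⊑-refl; trans to ⊑-trans)

  isMin-if-nothing-below : ∀ {x} → ¬ (∃ λ y → y ⊑ x × y ≢ x) → IsMin (asRel Q) x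
  isMin-if-nothing-below none = tt , λ y _ y⊑x → decidable-stable (y ≟ _) (λ y≢x → none (y , y⊑x , y≢x))

  isMax-if-nothing-above : ∀ {x} → ¬ (∃ λ y → x ⊑ y × y ≢ x) → IsMax (asRel Q) x
  isMax-if-nothing-above none = tt , λ y _ x⊑y → decidable-stable (y ≟ _) (λ y≢x → none (y , x⊑y , y≢x))

  ¬isMin⇒below : ∀ {x} → ¬ IsMin (asRel Q) x → ∃ λ y → y ⊑ x × y ≢ x
  ¬isMin⇒below {x} ¬min =
    decidable-stable (any? λ y → (y ⊑? x) ×-dec ¬? (y ≟ x)) (λ none → ¬min (isMin-if-nothing-below none))

  ¬isMax⇒above : ∀ {x} → ¬ IsMax (asRel Q) x → ∃ λ y → x ⊑ y × y ≢ x
  ¬isMax⇒above {x} ¬max =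
    decidable-stable (any? λ y → (x ⊑? y) ×-dec ¬? (y ≟ x)) (λ none → ¬max (isMax-if-nothing-above none))

  minimal-below : ∀ x → ∃ λ m → m ⊑ x × IsMin (asRel Q) m
  minimal-below x = go x (po-wellFounded isPartialOrder x)
    where
      go : ∀ x → Acc (ToStrict._<_ _≡_ _⊑_) x → ∃ λ m → m ⊑ x × IsMin (asRel Q) m
      go x (acc below) with isMin? (asRel Q) x
      ... | yes min = x , ⊑-refl , min
      ... | no ¬min =
        let (y , y⊑x , y≢x) = ¬isMin⇒below ¬min
            (m , m⊑y , min) = go y (below (y⊑x , y≢x))
        in  m , ⊑-trans m⊑y y⊑x , min

  maximal-above : ∀ x → ∃ λ m → x ⊑ m × IsMax (asRel Q) m
  maximal-above x = go x (po-noetherian isPartialOrder x)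
    where
      go : ∀ x → Acc (flip (ToStrict._<_ _≡_ _⊑_)) x → ∃ λ m → x ⊑ m × IsMax (asRel Q) m
      go x (acc above) with isMax? (asRel Q) x
      ... | yes max = x , ⊑-refl , max
      ... | no ¬max =
        let (y , x⊑y , y≢x) = ¬isMax⇒above ¬max
            (m , y⊑m , max) = go y (above (x⊑y , ≢-sym y≢x))
        in  m , ⊑-trans x⊑y y⊑m , max

module DeletionContraction {n : ℕ} (Q : FinPoset n) (e : Fin n)
                           (e-not-min : ¬ IsMin (asRel Q) e) (e-not-max : ¬ IsMax (asRel Q) e) where
  open FinPoset Q
  open IsPartialOrder isPartialOrder using (antisym) renaming (refl to ⊑-refl; trans to ⊑-trans)
  open FinitePoset Q

  U D : Fin n → Set
  U = Up Q e
  D = Down Q e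

  module /U   = Contraction (Q′ Q e) U (up? Q e)
  module /D   = Contraction (Q′ Q e) D (down? Q e)
  module /U/D = Contraction (Q′/U Q e) (liftP D) (liftP? (down? Q e))

  U-nonempty : ∃ U
  U-nonempty = ¬isMax⇒above e-not-max

  D-nonempty : ∃ D
  D-nonempty = ¬isMin⇒below e-not-min

  u d : Fin n
  u = proj₁ U-nonempty
  d = proj₁ D-nonempty

  u∈U : U u
  u∈U = proj₂ U-nonempty

  d∈D : D d
  d∈D = proj₂ D-nonempty

  D⇒¬U : ∀ {x} → D x → ¬ U x
  D⇒¬U (x⊑e , x≢e) (e⊑x , _) = x≢e (antisym x⊑e e⊑x)

  isMin′⇒¬U : ∀ {x} → IsMin (Q′ Q e) x → ¬ U x
  isMin′⇒¬U ((_ , x≢e) , min) (e⊑x , _) =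
    x≢e (antisym (subst (_⊑ e) (min d (tt , proj₂ d∈D) (⊑-trans (proj₁ d∈D) e⊑x)) (proj₁ d∈D)) e⊑x)

  isMax′⇒¬D : ∀ {x} → IsMax (Q′ Q e) x → ¬ D x
  isMax′⇒¬D ((_ , x≢e) , max) (x⊑e , _) =
    x≢e (antisym x⊑e (subst (e ⊑_) (max u (tt , proj₂ u∈U) (⊑-trans x⊑e (proj₁ u∈U))) (proj₁ u∈U)))

  isMin⇒isMin′ : ∀ {x} → IsMin (asRel Q) x → IsMin (Q′ Q e) x
  isMin⇒isMin′ min = (tt , λ { refl → e-not-min min }) , λ y _ → proj₂ min y tt

  isMax⇒isMax′ : ∀ {x} → IsMax (asRel Q) x → IsMax (Q′ Q e) x
  isMax⇒isMax′ max = (tt , λ { refl → e-not-max max }) , λ y _ → proj₂ max y tt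

  -- A minimal element of Q below x is not e, so it is x itself.
  isMin′⇒isMin : ∀ {x} → IsMin (Q′ Q e) x → IsMin (asRel Q) x
  isMin′⇒isMin {x} (_ , min′) =
    let (m , m⊑x , min) = minimal-below x
    in  subst (IsMin (asRel Q)) (min′ m (proj₁ (isMin⇒isMin′ min)) m⊑x) min

  isMax′⇒isMax : ∀ {x} → IsMax (Q′ Q e) x → IsMax (asRel Q) x
  isMax′⇒isMax {x} (_ , max′) =
    let (m , x⊑m , max) = maximal-above x
    in  subst (IsMax (asRel Q)) (max′ m (proj₁ (isMax⇒isMax′ max)) x⊑m) max

  minimal′-below : ∀ x → ∃ λ m → m ⊑ x × IsMin (Q′ Q e) m
  minimal′-below x = let (m , m⊑x , min) = minimal-below x in m , m⊑x , isMin⇒isMin′ min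

  maximal′-above : ∀ x → ∃ λ m → x ⊑ m × IsMax (Q′ Q e) m
  maximal′-above x = let (m , x⊑m , max) = maximal-above x in m , x⊑m , isMax⇒isMax′ max

  minimal′-in-D : ∃ λ m → IsMin (Q′ Q e) m × D m
  minimal′-in-D =
    let (m , m⊑d , min) = minimal′-below d in m , min , ⊑-trans m⊑d (proj₁ d∈D) , proj₂ (proj₁ min)

  maximal′-in-U : ∃ λ m → IsMax (Q′ Q e) m × U m
  maximal′-in-U =
    let (m , u⊑m , max) = maximal′-above u in m , max , ⊑-trans (proj₁ u∈U) u⊑m , proj₂ (proj₁ max)

  U-isMax/U : IsMax (Q′/U Q e) zero
  U-isMax/U = (u , (tt , proj₂ u∈U) , u∈U) , max
    where
      max : ∀ c → FinRel.El (Q′/U Q e) c → FinRel._≼_ (Q′/U Q e) zero c → c ≡ zero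
      max zero    _                 _ = refl
      max (suc y) ((_ , y≢e) , ¬Uy) (_ , _ , (_ , e⊑x , _) , refl , x⊑y) =
        ⊥-elim (¬Uy (⊑-trans e⊑x x⊑y , y≢e))

  D-isMin/D : IsMin (Q′/D Q e) zero
  D-isMin/D = (d , (tt , proj₂ d∈D) , d∈D) , min
    where
      min : ∀ c → FinRel.El (Q′/D Q e) c → FinRel._≼_ (Q′/D Q e) c zero → c ≡ zero
      min zero    _                 _ = refl
      min (suc y) ((_ , y≢e) , ¬Dy) (_ , _ , refl , (_ , x⊑e , _) , y⊑x) =
        ⊥-elim (¬Dy (⊑-trans y⊑x x⊑e , y≢e))

  d∈Q′/U : FinRel.El (Q′/U Q e) (suc d)
  d∈Q′/U = (tt , proj₂ d∈D) , D⇒¬U d∈D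

  d≼U : FinRel._≼_ (Q′/U Q e) (suc d) zero
  d≼U = d , u , refl , ((tt , proj₂ u∈U) , u∈U) , ⊑-trans (proj₁ d∈D) (proj₁ u∈U)

  D≼u : FinRel._≼_ (Q′/D Q e) zero (suc u)
  D≼u = d , u , ((tt , proj₂ d∈D) , d∈D) , refl , ⊑-trans (proj₁ d∈D) (proj₁ u∈U)

  U-¬isMin/U : ¬ IsMin (Q′/U Q e) zero
  U-¬isMin/U (_ , min) with () ← min (suc d) d∈Q′/U d≼U

  D-¬isMax/D : ¬ IsMax (Q′/D Q e) zero
  D-¬isMax/D (_ , max) with () ← max (suc u) ((tt , proj₂ u∈U) , λ u∈D → D⇒¬U u∈D u∈U) D≼u

  D-isMin/U/D : IsMin (Q′/U/D Q e) zero
  D-isMin/U/D = (suc d , d∈Q′/U , d∈D) , min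
    where
      min : ∀ c → FinRel.El (Q′/U/D Q e) c → FinRel._≼_ (Q′/U/D Q e) c zero → c ≡ zero
      min zero _ _ = refl
      min (suc zero) _ (_ , suc _ , refl , (_ , x∈D) , (y , _ , (_ , y∈U) , refl , y⊑x)) =
        ⊥-elim (D⇒¬U (⊑-trans y⊑x (proj₁ x∈D) , proj₂ y∈U) y∈U)
      min (suc (suc y)) (((_ , y≢e) , _) , ¬Dy) (_ , suc _ , refl , (_ , x∈D) , (_ , _ , refl , refl , y⊑x)) =
        ⊥-elim (¬Dy (⊑-trans y⊑x (proj₁ x∈D) , y≢e))

  U-isMax/U/D : IsMax (Q′/U/D Q e) (suc zero)
  U-isMax/U/D = /U/D.isMax-suc⁺ U-isMax/U (λ ())

  D≼U/U/D : FinRel._≼_ (Q′/U/D Q e) zero (suc zero)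
  D≼U/U/D = suc d , zero , (d∈Q′/U , d∈D) , refl , d≼U

  D-¬isMax/U/D : ¬ IsMax (Q′/U/D Q e) zero
  D-¬isMax/U/D (_ , max) with () ← max (suc zero) (proj₁ U-isMax/U/D) D≼U/U/D

  U-¬isMin/U/D : ¬ IsMin (Q′/U/D Q e) (suc zero)
  U-¬isMin/U/D (_ , min) with () ← min zero (proj₁ D-isMin/U/D) D≼U/U/D

  lift-avoids : ∀ {Z} → /D.Avoids Z → /U/D.Avoids (liftS Z)
  lift-avoids avoids (suc x) (there x∈Z) = avoids x x∈Z

  -- h lies below all of U, and a maximal element of Q′ above U is the common neighbour.
  connectedΔmax-reroute : ∀ {B h} → h ∈ B → D h → /U.Avoids B →
                          ConnectedΔmax (Q′/U Q e) (liftS B) → ConnectedΔmax (Q′ Q e) B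
  connectedΔmax-reroute {B} {h} h∈B h∈D avoids =
    /U.Maximal.connected-reroute avoids h (inj₁ (h∈B , λ max → isMax′⇒¬D max h∈D)) (D⇒¬U h∈D)
                                 detour h~U
    where
      h~U : ∀ x → U x → Comparable (Q′ Q e) h x
      h~U x x∈U = inj₁ (⊑-trans (proj₁ h∈D) (proj₁ x∈U))
      detour : ∀ x j → U j → Comparable (Q′ Q e) x j →
               ∃ λ m → SymDiff (Q′ Q e) B (IsMax (Q′ Q e)) m ×
                       Comparable (Q′ Q e) x m × Comparable (Q′ Q e) h m
      detour x j (e⊑j , _) x~j =
        let (w , x⊑w , e⊑w) = upper x~j
            (m , w⊑m , max) = maximal′-above w
            m∈U = ⊑-trans e⊑w w⊑m , proj₂ (proj₁ max)
        in  m , inj₂ ((λ m∈B → avoids m m∈B m∈U) , max) , inj₁ (⊑-trans x⊑w w⊑m) , h~U m m∈U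
        where
          upper : Comparable (Q′ Q e) x j → ∃ λ w → x ⊑ w × e ⊑ w
          upper (inj₁ x⊑j) = j , x⊑j , e⊑j
          upper (inj₂ j⊑x) = x , ⊑-refl , ⊑-trans e⊑j j⊑x

  connectedΔmin-reroute : ∀ {B h} → h ∈ B → U h → /D.Avoids B →
                          ConnectedΔmin (Q′/D Q e) (liftS B) → ConnectedΔmin (Q′ Q e) B
  connectedΔmin-reroute {B} {h} h∈B h∈U avoids =
    /D.Minimal.connected-reroute avoids h (inj₁ (h∈B , λ min → isMin′⇒¬U min h∈U)) (λ h∈D → D⇒¬U h∈D h∈U)
                                 detour h~D
    where
      h~D : ∀ x → D x → Comparable (Q′ Q e) h x
      h~D x x∈D = inj₂ (⊑-trans (proj₁ x∈D) (proj₁ h∈U))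
      detour : ∀ x j → D j → Comparable (Q′ Q e) x j →
               ∃ λ m → SymDiff (Q′ Q e) B (IsMin (Q′ Q e)) m ×
                       Comparable (Q′ Q e) x m × Comparable (Q′ Q e) h m
      detour x j (j⊑e , _) x~j =
        let (w , w⊑x , w⊑e) = lower x~j
            (m , m⊑w , min) = minimal′-below w
            m∈D = ⊑-trans m⊑w w⊑e , proj₂ (proj₁ min)
        in  m , inj₂ ((λ m∈B → avoids m m∈B m∈D) , min) , inj₂ (⊑-trans m⊑w w⊑x) , h~D m m∈D
        where
          lower : Comparable (Q′ Q e) x j → ∃ λ w → w ⊑ x × w ⊑ e
          lower (inj₁ x⊑j) = x , ⊑-refl , ⊑-trans x⊑j j⊑e
          lower (inj₂ j⊑x) = j , j⊑x , j⊑e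

  -- Q′/U/D is Q′/D with U contracted as well; the class U is neither in B nor minimal.
  connectedΔmin/D⇒/U/D : ∀ {B} → /U.Avoids B → /D.Avoids B →
                         ConnectedΔmin (Q′/D Q e) (liftS B) → ConnectedΔmin (Q′/U/D Q e) (liftS (liftS B))
  connectedΔmin/D⇒/U/D {B} avoidsU avoidsD = connected-image f f-into f-rel f-onto
    where
      S/D : Fin (suc n) → Set
      S/D = SymDiff (Q′/D Q e) (liftS B) (IsMin (Q′/D Q e))
      S/U/D : Fin (suc (suc n)) → Set
      S/U/D = SymDiff (Q′/U/D Q e) (liftS (liftS B)) (IsMin (Q′/U/D Q e))
      f : Fin (suc n) → Fin (suc (suc n))
      f zero    = zero
      f (suc x) = suc (suc x)
      ¬U : ∀ {x} → SymDiff (Q′ Q e) B (IsMin (Q′ Q e)) x → ¬ U x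
      ¬U (inj₁ (x∈B , _)) = avoidsU _ x∈B
      ¬U (inj₂ (_ , min)) = isMin′⇒¬U min
      f-into : ∀ {c} → S/D c → S/U/D (f c)
      f-into {zero}  _ = /U/D.Minimal.symDiff-zero⁺ D-isMin/U/D
      f-into {suc x} t =
        let (s , ¬Dx) = /D.Minimal.symDiff-suc⁻ avoidsD t
        in  /U/D.Minimal.symDiff-suc⁺ (/U.Minimal.symDiff-suc⁺ s (¬U s)) ¬Dx
      class~ : ∀ {y} → Comparable (Q′/D Q e) zero (suc y) → Comparable (Q′/U/D Q e) zero (suc (suc y))
      class~ D~y =
        let (x , _ , x∈D , x~y) = /D.comparable-class⁻ D~y
        in  /U/D.comparable-class⁺ x∈D ((tt , proj₂ x∈D) , D⇒¬U x∈D) (/U.comparable-suc⁺ x~y)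
      f-rel : ∀ {c c′} → S/D c → S/D c′ → Comparable (Q′/D Q e) c c′ →
              Comparable (Q′/U/D Q e) (f c) (f c′) ⊎ f c ≡ f c′
      f-rel {zero}  {zero}  _ _ _    = inj₂ refl
      f-rel {zero}  {suc _} _ _ D~y  = inj₁ (class~ D~y)
      f-rel {suc _} {zero}  _ _ x~D  = inj₁ (swap (class~ (swap x~D)))
      f-rel {suc _} {suc _} _ _ x~y  = inj₁ (/U/D.comparable-suc⁺ (/U.comparable-suc⁺ (/D.comparable-suc⁻ x~y)))
      f-onto : ∀ {c} → S/U/D c → ∃ λ c′ → S/D c′ × f c′ ≡ c
      f-onto {zero}        _ = zero , /D.Minimal.symDiff-zero⁺ D-isMin/D , refl
      f-onto {suc zero}    t =
        ⊥-elim (U-¬isMin/U (/U.Minimal.symDiff-zero⁻ (proj₁ (/U/D.Minimal.symDiff-suc⁻ (lift-avoids avoidsD) t))))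
      f-onto {suc (suc x)} t =
        let (t/U , ¬Dx) = /U/D.Minimal.symDiff-suc⁻ (lift-avoids avoidsD) t
            (s , _)     = /U.Minimal.symDiff-suc⁻ avoidsU t/U
        in  suc x , /D.Minimal.symDiff-suc⁺ s ¬Dx , refl

  module Counting {X Y : Subset n}
           (X∥e : ∀ x → x ∈ X → ¬ Comparable (asRel Q) e x)
           (Y∥e : ∀ y → y ∈ Y → ¬ Comparable (asRel Q) e y) where

    Counted′ Counted/U Counted/D Counted/U/D : Subset n → Set
    Counted′ B    = Counted (Q′ Q e) X Y B
    Counted/U B   = Counted (Q′/U Q e) (liftS X) (liftS Y) (liftS B)
    Counted/D B   = Counted (Q′/D Q e) (liftS X) (liftS Y) (liftS B)
    Counted/U/D B = Counted (Q′/U/D Q e) (liftS (liftS X)) (liftS (liftS Y)) (liftS (liftS B))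

    counted/U/D-from : ∀ {B} → IsXYAntichain (Q′ Q e) X Y B → /U.Avoids B → /D.Avoids B →
                       ConnectedΔmin (Q′/D Q e) (liftS B) → ConnectedΔmax (Q′/U Q e) (liftS B) → Counted/U/D B
    counted/U/D-from xy avoidsU avoidsD p/D q/U =
      /U/D.isXYAntichain-lift⁺ (lift-avoids X-avoids-D) (lift-avoids Y-avoids-D) (lift-avoids avoidsD)
        (/U.isXYAntichain-lift⁺ X-avoids-U Y-avoids-U avoidsU xy) ,
      connectedΔmin/D⇒/U/D avoidsU avoidsD p/D ,
      /U/D.Maximal.connected-lift⁺ (lift-avoids avoidsD) isMax/U⇒¬D D-¬isMax/U/D q/U
      where
        X-avoids-U : /U.Avoids X
        X-avoids-U x x∈X x∈U = X∥e x x∈X (inj₁ (proj₁ x∈U))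
        Y-avoids-U : /U.Avoids Y
        Y-avoids-U y y∈Y y∈U = Y∥e y y∈Y (inj₁ (proj₁ y∈U))
        X-avoids-D : /D.Avoids X
        X-avoids-D x x∈X x∈D = X∥e x x∈X (inj₂ (proj₁ x∈D))
        Y-avoids-D : /D.Avoids Y
        Y-avoids-D y y∈Y y∈D = Y∥e y y∈Y (inj₂ (proj₁ y∈D))
        isMax/U⇒¬D : ∀ {c} → IsMax (Q′/U Q e) c → ¬ liftP D c
        isMax/U⇒¬D {zero}  _   ()
        isMax/U⇒¬D {suc x} max = isMax′⇒¬D (/U.isMax-suc⁻ max)

    counted/U⁻ : ∀ {B} → Counted/U B →
                 IsXYAntichain (Q′ Q e) X Y B × /U.Avoids B ×
                 ConnectedΔmin (Q′ Q e) B × ConnectedΔmax (Q′/U Q e) (liftS B)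
    counted/U⁻ (xy/U , p/U , q/U) =
      let (xy , avoids) = /U.isXYAntichain-lift⁻ xy/U
      in  xy , avoids , /U.Minimal.connected-lift⁻ avoids isMin′⇒¬U U-¬isMin/U p/U , q/U

    counted/D⁻ : ∀ {B} → Counted/D B →
                 IsXYAntichain (Q′ Q e) X Y B × /D.Avoids B ×
                 ConnectedΔmin (Q′/D Q e) (liftS B) × ConnectedΔmax (Q′ Q e) B
    counted/D⁻ (xy/D , p/D , q/D) =
      let (xy , avoids) = /D.isXYAntichain-lift⁻ xy/D
      in  xy , avoids , p/D , /D.Maximal.connected-lift⁻ avoids isMax′⇒¬D D-¬isMax/D q/D

    counted/U×counted/D⇒ : ∀ {B} → Counted/U B → Counted/D B → Counted′ B × Counted/U/D B
    counted/U×counted/D⇒ k/U k/D =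
      let (xy , avoidsU , p , q/U) = counted/U⁻ k/U
          (_  , avoidsD , p/D , q) = counted/D⁻ k/D
      in  (xy , p , q) , counted/U/D-from xy avoidsU avoidsD p/D q/U

    counted/U⇒ : ∀ {B} → Counted/U B → Counted′ B ⊎ Counted/U/D B
    counted/U⇒ {B} k/U with counted/U⁻ k/U | any? (λ x → (x ∈? B) ×-dec down? Q e x)
    ... | xy , avoidsU , p , q/U | yes (h , h∈B , h∈D) =
      inj₁ (xy , p , connectedΔmax-reroute h∈B h∈D avoidsU q/U)
    ... | xy , avoidsU , p , q/U | no B∩D≢∅ =
      inj₂ (counted/U/D-from xy avoidsU avoidsD p/D q/U)
      where
        avoidsD : /D.Avoids B
        avoidsD x x∈B x∈D = B∩D≢∅ (x , x∈B , x∈D)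
        p/D : ConnectedΔmin (Q′/D Q e) (liftS B)
        p/D = /D.Minimal.connected-collapse avoidsD (proj₁ (proj₁ xy)) D-isMin/D minimal′-in-D p

    counted/D⇒ : ∀ {B} → Counted/D B → Counted′ B ⊎ Counted/U/D B
    counted/D⇒ {B} k/D with counted/D⁻ k/D | any? (λ x → (x ∈? B) ×-dec up? Q e x)
    ... | xy , avoidsD , p/D , q | yes (h , h∈B , h∈U) =
      inj₁ (xy , connectedΔmin-reroute h∈B h∈U avoidsD p/D , q)
    ... | xy , avoidsD , p/D , q | no B∩U≢∅ =
      inj₂ (counted/U/D-from xy avoidsU avoidsD p/D q/U)
      where
        avoidsU : /U.Avoids B
        avoidsU x x∈B x∈U = B∩U≢∅ (x , x∈B , x∈U)
        q/U : ConnectedΔmax (Q′/U Q e) (liftS B)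
        q/U = /U.Maximal.connected-collapse avoidsU (proj₁ (proj₁ xy)) U-isMax/U maximal′-in-U q

    counted′? : ∀ B → Dec (Counted′ B)
    counted′? B = counted? (Q′ Q e) X Y B

    counted/U? : ∀ B → Dec (Counted/U B)
    counted/U? B = counted? (Q′/U Q e) (liftS X) (liftS Y) (liftS B)

    counted/D? : ∀ B → Dec (Counted/D B)
    counted/D? B = counted? (Q′/D Q e) (liftS X) (liftS Y) (liftS B)

    counted/U/D? : ∀ B → Dec (Counted/U/D B)
    counted/U/D? B = counted? (Q′/U/D Q e) (liftS (liftS X)) (liftS (liftS Y)) (liftS (liftS B))

    ¬counted/U-∅ : AtLeastTwo (IsMin (asRel Q)) → ¬ Counted/U ∅
    ¬counted/U-∅ (a , b , a≢b , min-a , min-b) (_ , p/U , _) =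
      ¬connectedΔmin-∅ (Q′/U Q e) (λ eq → a≢b (suc-injective eq)) (isMin/U min-a) (isMin/U min-b) p/U
      where
        isMin/U : ∀ {x} → IsMin (asRel Q) x → IsMin (Q′/U Q e) (suc x)
        isMin/U min = /U.isMin-suc⁺ (isMin⇒isMin′ min) (isMin′⇒¬U (isMin⇒isMin′ min))

    ¬counted/D-∅ : AtLeastTwo (IsMax (asRel Q)) → ¬ Counted/D ∅
    ¬counted/D-∅ (a , b , a≢b , max-a , max-b) (_ , _ , q/D) =
      ¬connectedΔmax-∅ (Q′/D Q e) (λ eq → a≢b (suc-injective eq)) (isMax/D max-a) (isMax/D max-b) q/D
      where
        isMax/D : ∀ {x} → IsMax (asRel Q) x → IsMax (Q′/D Q e) (suc x)
        isMax/D max = /D.isMax-suc⁺ (isMax⇒isMax′ max) (isMax′⇒¬D (isMax⇒isMax′ max))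

    counted/U/D-∅ : (∀ x → x ∈ X → IsMax (asRel Q) x) → (∀ y → y ∈ Y → IsMin (asRel Q) y) →
                    (∀ x → IsMin (asRel Q) x → D x) → (∀ x → IsMax (asRel Q) x → U x) → Counted/U/D ∅
    counted/U/D-∅ X-max Y-min min⊆D max⊆U =
      ∅-isXYAntichain (Q′/U/D Q e) X-empty Y-empty ,
      connectedΔmin-∅ (Q′/U/D Q e) D-isMin/U/D only-D ,
      connectedΔmax-∅ (Q′/U/D Q e) U-isMax/U/D only-U
      where
        X-empty : ∀ c → c ∉ liftS (liftS X)
        X-empty (suc (suc x)) (there (there x∈X)) = X∥e x x∈X (inj₁ (proj₁ (max⊆U x (X-max x x∈X))))
        Y-empty : ∀ c → c ∉ liftS (liftS Y)
        Y-empty (suc (suc y)) (there (there y∈Y)) = Y∥e y y∈Y (inj₂ (proj₁ (min⊆D y (Y-min y y∈Y))))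
        only-D : ∀ c → IsMin (Q′/U/D Q e) c → c ≡ zero
        only-D zero          _   = refl
        only-D (suc zero)    min = ⊥-elim (U-¬isMin/U/D min)
        only-D (suc (suc x)) min =
          ⊥-elim (proj₂ (proj₁ min) (min⊆D x (isMin′⇒isMin (/U.isMin-suc⁻ (/U/D.isMin-suc⁻ min)))))
        only-U : ∀ c → IsMax (Q′/U/D Q e) c → c ≡ suc zero
        only-U zero          max = ⊥-elim (D-¬isMax/U/D max)
        only-U (suc zero)    _   = refl
        only-U (suc (suc x)) max =
          ⊥-elim (proj₂ (proj₁ (proj₁ max)) (max⊆U x (isMax′⇒isMax (/U.isMax-suc⁻ (/U/D.isMax-suc⁻ max)))))

    indicator-pointwise : ∀ B → indicator (counted/U? B) + indicator (counted/D? B) ≤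
                                indicator (counted′? B) + indicator (counted/U/D? B)
    indicator-pointwise B =
      indicator-+-≤ (counted/U? B) (counted/D? B) (counted′? B) (counted/U/D? B)
                    counted/U×counted/D⇒ counted/U⇒ counted/D⇒

    α-contractions≡ : α (Q′/U Q e) (liftS X) (liftS Y) + α (Q′/D Q e) (liftS X) (liftS Y) ≡
                      length (filter counted/U? (allSubsets n)) + length (filter counted/D? (allSubsets n))
    α-contractions≡ =
      cong₂ _+_ (trans (α-unfold (Q′/U Q e) (liftS X) (liftS Y))
                       (length-filter-allSubsets-outside (counted? (Q′/U Q e) (liftS X) (liftS Y))
                                                         (λ _ → /U.¬counted-inside-if-class-max U-isMax/U)))
                (trans (α-unfold (Q′/D Q e) (liftS X) (liftS Y))
                       (length-filter-allSubsets-outside (counted? (Q′/D Q e) (liftS X) (liftS Y))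
                                                         (λ _ → /D.¬counted-inside-if-class-min D-isMin/D)))

    α-deletion-≥ : length (filter counted′? (allSubsets n)) + length (filter counted/U/D? (allSubsets n)) ≤
                   α (Q′ Q e) X Y + α (Q′/U/D Q e) (liftS (liftS X)) (liftS (liftS Y))
    α-deletion-≥ =
      +-mono-≤ (≤-reflexive (sym (α-unfold (Q′ Q e) X Y)))
        (≤-trans (length-filter-allSubsets-outside-≤ (λ B → counted? (Q′/U/D Q e) X″ Y″ (liftS B)))
        (≤-trans (length-filter-allSubsets-outside-≤ (counted? (Q′/U/D Q e) X″ Y″))
                 (≤-reflexive (sym (α-unfold (Q′/U/D Q e) X″ Y″)))))
      where
        X″ Y″ : Subset (suc (suc n))
        X″ = liftS (liftS X)
        Y″ = liftS (liftS Y)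

lemma4p10 : ∀ {n : ℕ} (Q : FinPoset n) (e : Fin n) (X Y : Subset n) →
    ConnectedIn (asRel Q) (λ _ → ⊤) →
    ¬ IsMin (asRel Q) e → ¬ IsMax (asRel Q) e →
    (∀ x → x ∈ X → IsMax (asRel Q) x) →
    (∀ y → y ∈ Y → IsMin (asRel Q) y) →
    (∀ x → x ∈ X → ¬ Comparable (asRel Q) e x) →
    (∀ y → y ∈ Y → ¬ Comparable (asRel Q) e y) →
    (∀ x y → x ∈ X → y ∈ Y → ¬ Comparable (asRel Q) x y) →
    (α (Q′/U Q e) (liftS X) (liftS Y) + α (Q′/D Q e) (liftS X) (liftS Y)
       ≤ α (Q′ Q e) X Y + α (Q′/U/D Q e) (liftS (liftS X)) (liftS (liftS Y)))
    ×
    ((∀ x → IsMin (asRel Q) x → Down Q e x) →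
     (∀ x → IsMax (asRel Q) x → Up Q e x) →
     AtLeastTwo (IsMin (asRel Q)) →
     AtLeastTwo (IsMax (asRel Q)) →
     α (Q′/U Q e) (liftS X) (liftS Y) + α (Q′/D Q e) (liftS X) (liftS Y)
       < α (Q′ Q e) X Y + α (Q′/U/D Q e) (liftS (liftS X)) (liftS (liftS Y)))
lemma4p10 {n} Q e X Y _ e-not-min e-not-max X-max Y-min X∥e Y∥e _ =
  ≤-trans (≤-reflexive α-contractions≡)
    (≤-trans (length-filter-+-≤ counted/U? counted/D? counted′? counted/U/D? indicator-pointwise (allSubsets n))
             α-deletion-≥) ,
  λ min⊆D max⊆U two-min two-max →
    ≤-<-trans (≤-reflexive α-contractions≡)
      (<-≤-trans (length-filter-+-< counted/U? counted/D? counted′? counted/U/D? indicator-pointwise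
                    (indicator-+-< (counted/U? ∅) (counted/D? ∅) (counted′? ∅) (counted/U/D? ∅)
                                   (¬counted/U-∅ two-min) (¬counted/D-∅ two-max)
                                   (inj₂ (counted/U/D-∅ X-max Y-min min⊆D max⊆U)))
                    (∈-allSubsets ∅))
                 α-deletion-≥)
  where
    open DeletionContraction Q e e-not-min e-not-max
    open Counting X∥e Y∥e
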